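{- For all Plotkin terms $t$, normal forms $n$ and $k\ge0$: $t\Downarrow_kn$ if and only if $t\to_w^kn$ with $n$ $\to_w$-normal.
   Context: Plotkin terms $t::=v\mid tu$, values $v::=x\mid\lambda x.t$. Root rule $(\lambda x.t)v\mapsto t\{x:=v\}$ ($v$ value); weak reduction $\to_w$ is its closure under $W::=\langle\cdot\rangle\mid tW\mid Wt$; $\to_w^k$ denotes exactly $k$ steps. Big-step weak evaluation $t\Downarrow_kn$ is defined by the rules: $v\Downarrow_0v$ for every value $v$; if $t\Downarrow_k\lambda x.s$, $u\Downarrow_hv$ ($v$ a value) and $s\{x:=v\}\Downarrow_in$ then $tu\Downarrow_{k+h+i+1}n$; if $t\Downarrow_kn$ and $u\Downarrow_hn'$ and $nn'$ is $\to_w$-normal then $tu\Downarrow_{k+h}nn'$. -}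

module Defs where

open import Data.Nat using (ℕ; zero; suc; _+_; _<ᵇ_)
open import Data.Bool using (if_then_else_)
open import Data.Product using (∃)
open import Relation.Nullary using (¬_)

-- Plotkin's (call-by-value) λ-terms, with variables as de Bruijn indices
-- (names up to α-equivalence).
data Term : Set where
  var : ℕ → Term
  lam : Term → Term
  app : Term → Term → Term

data Value : Term → Set where
  var : (x : ℕ) → Value (var x)
  lam : (t : Term) → Value (lam t)

shift : ℕ → ℕ → Term → Term
shift d c (var x)   = if x <ᵇ c then var x else var (x + d)
shift d c (lam t)   = lam (shift d (suc c) t)
shift d c (app t u) = app (shift d c t) (shift d c u)

substAt : ℕ → Term → Term → Term
substAt j (var x)   u with x <ᵇ j
... | Data.Bool.true  = var x
... | Data.Bool.false with j <ᵇ x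
...   | Data.Bool.true  = var (Data.Nat.pred x)
...   | Data.Bool.false = shift j 0 u
substAt j (lam t)   u = lam (substAt (suc j) t u)
substAt j (app t s) u = app (substAt j t u) (substAt j s u)

-- t{x:=u} where t is the body of λx.t
_[_] : Term → Term → Term
t [ u ] = substAt 0 t u

data _→w_ : Term → Term → Set where
  βv   : ∀ {t v} → Value v → app (lam t) v →w (t [ v ])
  appR : ∀ {t u u'} → u →w u' → app t u →w app t u'
  appL : ∀ {t t' u} → t →w t' → app t u →w app t' u

data _→w^_⟨_⟩ : Term → ℕ → Term → Set where
  done : ∀ {t} → t →w^ 0 ⟨ t ⟩
  step : ∀ {t t' t'' k} → t →w t' → t' →w^ k ⟨ t'' ⟩ → t →w^ suc k ⟨ t'' ⟩

Normal : Term → Set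
Normal t = ¬ (∃ λ t' → t →w t')

data _⇓[_]_ : Term → ℕ → Term → Set where
  val   : ∀ {v} → Value v → v ⇓[ 0 ] v
  beta  : ∀ {t u s v n k h i} →
          t ⇓[ k ] lam s → u ⇓[ h ] v → Value v → (s [ v ]) ⇓[ i ] n →
          app t u ⇓[ k + h + i + 1 ] n
  stuck : ∀ {t u n n' k h} →
          t ⇓[ k ] n → u ⇓[ h ] n' → Normal (app n n') →
          app t u ⇓[ k + h ] app n n'

-- Soundness: each rule of ⇓ is simulated by weak steps in the evaluation contexts
-- W t and t W, the β-rule contributing the one extra step.  Completeness: a normal
-- form evaluates to itself in 0 steps (values by `val`, stuck applications by
-- `stuck`), and ⇓ is closed under weak expansion, each expansion costing one step.
module Submission where

open import Defs
open import Data.Nat using (ℕ; suc; _+_)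
open import Data.Nat.Properties using (+-comm; +-assoc; +-suc)
open import Data.Product using (_×_; _,_)
open import Function.Bundles using (_⇔_; mk⇔)
open import Relation.Binary.PropositionalEquality using (_≡_; refl; cong; module ≡-Reasoning)

steps-cast : ∀ {t n k k'} → k ≡ k' → t →w^ k ⟨ n ⟩ → t →w^ k' ⟨ n ⟩
steps-cast refl p = p

⇓-cast : ∀ {t n k k'} → k ≡ k' → t ⇓[ k ] n → t ⇓[ k' ] n
⇓-cast refl d = d

infixr 5 _◅◅_

_◅◅_ : ∀ {t u v a b} → t →w^ a ⟨ u ⟩ → u →w^ b ⟨ v ⟩ → t →w^ (a + b) ⟨ v ⟩
done     ◅◅ q = q
step r p ◅◅ q = step r (p ◅◅ q)

appL-steps : ∀ {t t' u k} → t →w^ k ⟨ t' ⟩ → app t u →w^ k ⟨ app t' u ⟩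
appL-steps done       = done
appL-steps (step r p) = step (appL r) (appL-steps p)

appR-steps : ∀ {t u u' k} → u →w^ k ⟨ u' ⟩ → app t u →w^ k ⟨ app t u' ⟩
appR-steps done       = done
appR-steps (step r p) = step (appR r) (appR-steps p)

value⇒normal : ∀ {v} → Value v → Normal v
value⇒normal (var x) (_ , ())
value⇒normal (lam t) (_ , ())

normal-appL : ∀ {a b} → Normal (app a b) → Normal a
normal-appL nf (a' , r) = nf (_ , appL r)

normal-appR : ∀ {a b} → Normal (app a b) → Normal b
normal-appR nf (b' , r) = nf (_ , appR r)

beta-cost : ∀ k h i → k + (h + suc i) ≡ k + h + i + 1
beta-cost k h i = begin
  k + (h + suc i)   ≡⟨ +-assoc k h (suc i) ⟨
  k + h + suc i     ≡⟨ +-suc (k + h) i ⟩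
  suc (k + h + i)   ≡⟨ +-comm 1 (k + h + i) ⟩
  k + h + i + 1     ∎
  where open ≡-Reasoning

⇓⇒steps : ∀ {t k n} → t ⇓[ k ] n → t →w^ k ⟨ n ⟩
⇓⇒steps (val v) = done
⇓⇒steps (beta {k = k} {h} {i} d e v f) =
  steps-cast (beta-cost k h i)
    (appL-steps (⇓⇒steps d) ◅◅ appR-steps (⇓⇒steps e) ◅◅ step (βv v) (⇓⇒steps f))
⇓⇒steps (stuck d e nf) = appL-steps (⇓⇒steps d) ◅◅ appR-steps (⇓⇒steps e)

⇓⇒normal : ∀ {t k n} → t ⇓[ k ] n → Normal n
⇓⇒normal (val v)        = value⇒normal v
⇓⇒normal (beta _ _ _ f) = ⇓⇒normal f
⇓⇒normal (stuck _ _ nf) = nf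

normal⇒⇓ : ∀ n → Normal n → n ⇓[ 0 ] n
normal⇒⇓ (var x)   nf = val (var x)
normal⇒⇓ (lam t)   nf = val (lam t)
normal⇒⇓ (app a b) nf =
  stuck (normal⇒⇓ a (normal-appL nf)) (normal⇒⇓ b (normal-appR nf)) nf

⇓-expand : ∀ {t t' k n} → t →w t' → t' ⇓[ k ] n → t ⇓[ suc k ] n
⇓-expand (βv {t = s} v) d =
  ⇓-cast (+-comm _ 1) (beta (val (lam s)) (val v) v d)
⇓-expand (appL r) (beta d e v f) = beta (⇓-expand r d) e v f
⇓-expand (appL r) (stuck d e nf) = stuck (⇓-expand r d) e nf
⇓-expand (appR r) (beta {k = k} {h} {i} d e v f) =
  ⇓-cast (cong (λ m → m + i + 1) (+-suc k h)) (beta d (⇓-expand r e) v f)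
⇓-expand (appR r) (stuck {k = k} {h} d e nf) =
  ⇓-cast (+-suc k h) (stuck d (⇓-expand r e) nf)

steps⇒⇓ : ∀ {t k n} → t →w^ k ⟨ n ⟩ → Normal n → t ⇓[ k ] n
steps⇒⇓ done       nf = normal⇒⇓ _ nf
steps⇒⇓ (step r p) nf = ⇓-expand r (steps⇒⇓ p nf)

proposition7p2 : (t n : Term) → Normal n → (k : ℕ) →
    (t ⇓[ k ] n) ⇔ ((t →w^ k ⟨ n ⟩) × Normal n)
proposition7p2 t n nf k =
  mk⇔ (λ d → ⇓⇒steps d , ⇓⇒normal d) (λ (p , nf) → steps⇒⇓ p nf)
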